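{- Let $X \subseteq B^n$ be a sequence set whose set of prunable channels $p(X)$ is nonempty. Then $s(X) \ge H_{1+\max}\,\{\, s(X/i) \mid i \in p(X) \,\}_\#$, where the argument is a multiset (one entry for each $i\in p(X)$).
   Context: $B=\{0,1\}$, $[n]=\{1,\dots,n\}$. A comparator $[i,j]$ ($i\ne j\in[n]$) maps $x\in B^n$ to the sequence obtained by replacing $x_i$ by $\min(x_i,x_j)$ and $x_j$ by $\max(x_i,x_j)$; an exchange $(i,j)$ swaps entries $i$ and $j$. A comparator network on $n$ channels is a finite sequence of comparators and exchanges applied left to right; its size is its number of comparators. For $X\subseteq B^n$, a partial sorting network on $X$ is a comparator network whose output on every $x\in X$ is sorted (nondecreasing); $s(X)$ is the minimal size of a partial sorting network on $X$. For $x\in B^n$ and $i\in[n]$, $x/i\in B^{n-1}$ is $x$ with entry $i$ deleted; $X/i=\{x/i \mid x\in X,\ x_i=1\}$. The one-hot sequence $e^{(i,n)}\in B^n$ has entry $1$ at position $i$ and $0$ elsewhere; channel $i$ is prunable for $X$ if $e^{(i,n)}\in X$, and $p(X)$ is the set of prunable channels. For a nonempty finite multiset $L$ of nonnegative integers, $H_{1+\max} L$ is computed as follows: while the multiset has more than one element, remove two smallest elements $a,b$ and insert $1+\max(a,b)$; return the single remaining element. -}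

module Defs where

open import Data.Bool using (Bool; true; false; _∧_; _∨_; _≤_)
open import Data.Nat using (ℕ; zero; suc; _⊔_; _≤ᵇ_) renaming (_≤_ to _≤ℕ_)
open import Data.Fin using (Fin; zero; suc)
open import Data.Vec using (Vec; []; _∷_; lookup; _[_]≔_; insertAt; replicate)
open import Data.List using (List; []; _∷_; length; filterᵇ; map)
open import Data.List.Base using (allFin)
open import Data.Product using (∃; _×_)
open import Data.Unit using (⊤)
open import Relation.Binary.PropositionalEquality using (_≡_; _≢_)

SeqSet : ℕ → Set
SeqSet n = Vec Bool n → Bool

data Op (n : ℕ) : Set where
  cmp  : (i j : Fin n) → i ≢ j → Op n
  exch : (i j : Fin n) → Op n

Network : ℕ → Set
Network n = List (Op n)

applyOp : ∀ {n} → Op n → Vec Bool n → Vec Bool n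
applyOp (cmp i j _) x =
  ((x [ i ]≔ (lookup x i ∧ lookup x j)) [ j ]≔ (lookup x i ∨ lookup x j))
applyOp (exch i j) x = (x [ i ]≔ lookup x j) [ j ]≔ lookup x i

run : ∀ {n} → Network n → Vec Bool n → Vec Bool n
run []       x = x
run (o ∷ os) x = run os (applyOp o x)

size : ∀ {n} → Network n → ℕ
size []               = zero
size (cmp _ _ _ ∷ os) = suc (size os)
size (exch _ _ ∷ os)  = size os

Sorted : ∀ {n} → Vec Bool n → Set
Sorted []           = ⊤
Sorted (a ∷ [])     = ⊤
Sorted (a ∷ b ∷ xs) = (a ≤ b) × Sorted (b ∷ xs)

SortsOn : ∀ {n} → SeqSet n → Network n → Set
SortsOn {n} X C = (x : Vec Bool n) → X x ≡ true → Sorted (run C x)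

IsMinSize : ∀ {n} → SeqSet n → ℕ → Set
IsMinSize {n} X k =
  (∃ λ (C : Network n) → SortsOn X C × size C ≡ k)
  × ((C : Network n) → SortsOn X C → k ≤ℕ size C)

-- X/i = { x/i | x ∈ X, x_i = 1 }; y ∈ X/i iff (y with 1 inserted at i) ∈ X
_/_ : ∀ {m} → SeqSet (suc m) → Fin (suc m) → SeqSet m
(X / i) y = X (insertAt y i true)

oneHot : ∀ {n} → Fin n → Vec Bool n
oneHot {n} i = replicate n false [ i ]≔ true

prunable : ∀ {n} → SeqSet n → List (Fin n)
prunable {n} X = filterᵇ (λ i → X (oneHot i)) (allFin n)

insertSorted : ℕ → List ℕ → List ℕ
insertSorted a []       = a ∷ []
insertSorted a (b ∷ bs) with a ≤ᵇ b
... | true  = a ∷ b ∷ bs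
... | false = b ∷ insertSorted a bs

sortℕ : List ℕ → List ℕ
sortℕ []       = []
sortℕ (a ∷ as) = insertSorted a (sortℕ as)

-- on a sorted list: repeatedly replace the two smallest a,b by 1+max(a,b)
-- (fuel ≥ length suffices, since each step shortens the list by one)
Hgo : ℕ → List ℕ → ℕ
Hgo _         []           = zero   -- unused (multiset nonempty)
Hgo _         (a ∷ [])     = a
Hgo zero      (a ∷ b ∷ l)  = zero   -- unreachable with enough fuel
Hgo (suc f)   (a ∷ b ∷ l)  = Hgo f (insertSorted (suc (a ⊔ b)) l)

H1max : List ℕ → ℕ
H1max l = Hgo (length l) (sortℕ l)

module Submission where

-- Fix a smallest network C sorting X. Feeding C an input with a 1 on a prunable
-- channel i and following that 1 (a comparator sends it to its max output) traces a
-- path; deleting the channel that carries it at each moment turns C into a network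
-- on the remaining channels that sorts X/i and has hits C i fewer comparators, hits C i
-- being the number of comparators the path meets. So s(X/i) + hits C i ≤ s(X). Since
-- C sorts e_i, every such path ends at the last channel; paths only merge at
-- comparators, where both pay one, which gives Kraft's inequality
-- ∑ 2 ^ (- hits C i) ≤ 1 and hence ∑ 2 ^ s(X/i) ≤ 2 ^ s(X). Finally, repeatedly
-- merging the two smallest entries into 1 + max keeps ∑ 2 ^ l ≤ 2 ^ T, because all
-- other entries and 2 ^ T are multiples of the larger merged power.

open import Defs
open import Data.Bool using (Bool; true; false; _∧_; _∨_; T)
open import Data.Bool.Properties using (∧-identityʳ; ∨-zeroʳ; T?; T-≡) renaming (≤-trans to ≤ᴮ-trans)
open import Data.Nat using (ℕ; zero; suc; _+_; _*_; _^_; _∸_; _≤_; _<_; z≤n; s≤s; _≤ᵇ_)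
open import Data.Nat.Divisibility using (_∣_; divides; ∣-refl; _∣0; ∣m∣n⇒∣m+n)
open import Data.Nat.Properties hiding (suc-injective; _≟_)
open import Algebra.Properties.CommutativeSemigroup +-commutativeSemigroup using () renaming (interchange to +-interchange; x∙yz≈y∙xz to x+[y+z]≡y+[x+z])
open import Data.Fin using (Fin; zero; suc; _≟_; punchOut; fromℕ)
open import Data.Fin.Properties using (suc-injective; punchOut-injective)
open import Data.Fin.Permutation.Components using (transpose; transpose-inverse)
open import Data.Vec using (Vec; []; _∷_; tail; lookup; _[_]≔_; removeAt; insertAt; replicate)
open import Data.Vec.Properties using (lookup-replicate; insertAt-lookup; removeAt-insertAt; lookup∘updateAt; lookup∘updateAt′; []≔-lookup; []≔-commutes; removeAt-punchOut)
open import Data.List using (List; []; _∷_; _++_; map; length; allFin)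
open import Data.List.Membership.Propositional using (_∈_)
open import Data.List.Relation.Unary.Any using (here; there)
open import Data.List.Properties using (map-∘)
open import Data.List.Relation.Unary.All as All using (All; []; _∷_)
open import Data.List.Relation.Unary.All.Properties using (all-filter) renaming (map⁺ to All-map⁺)
open import Data.List.Relation.Unary.Unique.Propositional using (Unique)
import Data.List.Relation.Unary.Unique.Propositional.Properties as Unique
open import Data.List.Relation.Unary.AllPairs using (AllPairs; []; _∷_)
open import Data.List.Relation.Binary.Permutation.Propositional as ↭ using (_↭_; ↭-sym)
open import Data.List.Relation.Binary.Permutation.Propositional.Properties using (All-resp-↭) renaming (map⁺ to ↭-map⁺)
open import Data.Nat.ListAction.Properties using (sum-↭)
open import Data.Nat.ListAction using (sum)
open import Data.Nat.Tactic.RingSolver using (solve-∀)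
open import Data.Product using (_×_; _,_; proj₁; proj₂; map₁; ∃)
open import Data.Sum using (_⊎_; inj₁; inj₂; [_,_]′)
open import Data.Empty using (⊥-elim)
open import Relation.Nullary using (yes; no)
open import Relation.Binary.PropositionalEquality
open import Function using (_∘_)
open import Function.Bundles using (Equivalence)

removeAt-suc : ∀ {A : Set} {n} (v : A) (x : Vec A (suc n)) (i : Fin (suc n)) →
  removeAt (v ∷ x) (suc i) ≡ v ∷ removeAt x i
removeAt-suc v (u ∷ x) i = refl

lookup-[]≔ : ∀ {A : Set} {n} (x : Vec A n) (i : Fin n) (v : A) → lookup (x [ i ]≔ v) i ≡ v
lookup-[]≔ x i v = lookup∘updateAt i x

lookup-[]≔-≢ : ∀ {A : Set} {n} (x : Vec A n) {i j : Fin n} (v : A) → i ≢ j → lookup (x [ j ]≔ v) i ≡ lookup x i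
lookup-[]≔-≢ x {i} {j} v i≢j = lookup∘updateAt′ i j i≢j x

removeAt-[]≔ : ∀ {A : Set} {n} (x : Vec A (suc n)) (i : Fin (suc n)) (v : A) →
  removeAt (x [ i ]≔ v) i ≡ removeAt x i
removeAt-[]≔ (u ∷ x)         zero    v = refl
removeAt-[]≔ (u ∷ x@(_ ∷ _)) (suc i) v
  rewrite removeAt-suc u (x [ i ]≔ v) i = cong (u ∷_) (removeAt-[]≔ x i v)

removeAt-[]≔-punchOut : ∀ {A : Set} {n} (x : Vec A (suc n)) {c i : Fin (suc n)} (c≢i : c ≢ i) (v : A) →
  removeAt (x [ i ]≔ v) c ≡ removeAt x c [ punchOut c≢i ]≔ v
removeAt-[]≔-punchOut (u ∷ x)         {zero}  {zero}  c≢i v = ⊥-elim (c≢i refl)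
removeAt-[]≔-punchOut (u ∷ x)         {zero}  {suc i} c≢i v = refl
removeAt-[]≔-punchOut (u ∷ w ∷ x)     {suc c} {zero}  c≢i v = refl
removeAt-[]≔-punchOut (u ∷ x@(_ ∷ _)) {suc c} {suc i} c≢i v
  rewrite removeAt-suc u (x [ i ]≔ v) c = cong (u ∷_) (removeAt-[]≔-punchOut x (c≢i ∘ cong suc) v)

replicate-[]≔ : ∀ {A : Set} {n} (i : Fin n) (v : A) → replicate n v [ i ]≔ v ≡ replicate n v
replicate-[]≔ zero    v = refl
replicate-[]≔ (suc i) v = cong (v ∷_) (replicate-[]≔ i v)

removeAt-replicate : ∀ {A : Set} {n} (i : Fin (suc n)) (v : A) → removeAt (replicate (suc n) v) i ≡ replicate n v
removeAt-replicate zero            v = refl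
removeAt-replicate {n = suc n} (suc i) v = cong (v ∷_) (removeAt-replicate i v)

removeAt-oneHot : ∀ {n} (i : Fin (suc n)) → removeAt (oneHot i) i ≡ replicate n false
removeAt-oneHot {n} i = trans (removeAt-[]≔ (replicate (suc n) false) i true) (removeAt-replicate i false)

lookup-oneHot : ∀ {n} (i : Fin n) → lookup (oneHot i) i ≡ true
lookup-oneHot {n} i = lookup-[]≔ (replicate n false) i true

Sorted-tail : ∀ {n} (v : Bool) (x : Vec Bool n) → Sorted (v ∷ x) → Sorted x
Sorted-tail v []      _       = _
Sorted-tail v (_ ∷ _) (_ , s) = s

Sorted-removeAt : ∀ {n} (x : Vec Bool (suc n)) (i : Fin (suc n)) → Sorted x → Sorted (removeAt x i)
Sorted-removeAt (u ∷ x)                 zero          s              = Sorted-tail u x s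
Sorted-removeAt (u ∷ v ∷ [])            (suc zero)    _              = _
Sorted-removeAt (u ∷ v ∷ w ∷ x)         (suc zero)    (u≤v , v≤w , s) = ≤ᴮ-trans u≤v v≤w , s
Sorted-removeAt (u ∷ v ∷ x@(_ ∷ _))     (suc (suc i)) (u≤v , s)      = u≤v , Sorted-removeAt (v ∷ x) (suc i) s

lone-true-at-last : ∀ {n} (x : Vec Bool (suc n)) (i : Fin (suc n)) → Sorted x → lookup x i ≡ true →
  removeAt x i ≡ replicate n false → i ≡ fromℕ n
lone-true-at-last {zero}  (u ∷ [])            zero    _         _  _    = refl
lone-true-at-last {suc n} (true ∷ false ∷ x)  zero    (() , _)  _  _
lone-true-at-last {suc n} (u ∷ x@(_ ∷ _))     (suc i) s         xi rest =
  cong suc (lone-true-at-last x i (Sorted-tail u x s) xi (cong tail rest))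

run-++ : ∀ {n} (C D : Network n) (x : Vec Bool n) → run (C ++ D) x ≡ run D (run C x)
run-++ []      D x = refl
run-++ (o ∷ C) D x = run-++ C D (applyOp o x)

size-++ : ∀ {n} (C D : Network n) → size (C ++ D) ≡ size C + size D
size-++ []               D = refl
size-++ (cmp _ _ _ ∷ C)  D = cong suc (size-++ C D)
size-++ (exch _ _ ∷ C)   D = size-++ C D

liftOp : ∀ {n} → Op n → Op (suc n)
liftOp (cmp i j i≢j) = cmp (suc i) (suc j) (i≢j ∘ suc-injective)
liftOp (exch i j)    = exch (suc i) (suc j)

lift : ∀ {n} → Network n → Network (suc n)
lift = map liftOp

run-lift : ∀ {n} (C : Network n) (v : Bool) (x : Vec Bool n) → run (lift C) (v ∷ x) ≡ v ∷ run C x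
run-lift []              v x = refl
run-lift (cmp _ _ _ ∷ C) v x = run-lift C v _
run-lift (exch _ _ ∷ C)  v x = run-lift C v _

size-lift : ∀ {n} (C : Network n) → size (lift C) ≡ size C
size-lift []              = refl
size-lift (cmp _ _ _ ∷ C) = cong suc (size-lift C)
size-lift (exch _ _ ∷ C)  = size-lift C

run-replicate-false : ∀ {n} (C : Network n) → run C (replicate n false) ≡ replicate n false
run-replicate-false []               = refl
run-replicate-false (cmp i j _ ∷ C)
  rewrite lookup-replicate i false | lookup-replicate j false
        | replicate-[]≔ i false | replicate-[]≔ j false = run-replicate-false C
run-replicate-false (exch i j ∷ C)
  rewrite lookup-replicate i false | lookup-replicate j false
        | replicate-[]≔ i false | replicate-[]≔ j false = run-replicate-false C

swap₀₁ : ∀ {n} → Op (suc (suc n))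
swap₀₁ = exch zero (suc zero)

toFront : ∀ {n} → Fin (suc n) → Network (suc n)
toFront zero            = []
toFront {suc n} (suc i) = lift (toFront i) ++ swap₀₁ ∷ []

fromFront : ∀ {n} → Fin (suc n) → Network (suc n)
fromFront zero            = []
fromFront {suc n} (suc i) = swap₀₁ ∷ lift (fromFront i)

-- Relabels the remaining channels when the deleted channel moves from i to j.
relocate : ∀ {n} → Fin (suc n) → Fin (suc n) → Network n
relocate zero    zero                = []
relocate {suc n} zero    (suc j)     = toFront j
relocate {suc n} (suc i) zero        = fromFront i
relocate {suc n} (suc i) (suc j)     = lift (relocate i j)

run-toFront : ∀ {n} (i : Fin (suc n)) (x : Vec Bool (suc n)) → run (toFront i) x ≡ lookup x i ∷ removeAt x i
run-toFront zero    (v ∷ x) = refl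
run-toFront {suc n} (suc i) (v ∷ x@(_ ∷ _))
  rewrite run-++ (lift (toFront i)) (swap₀₁ ∷ []) (v ∷ x) | run-lift (toFront i) v x | run-toFront i x = refl

run-fromFront : ∀ {n} (i : Fin (suc n)) (v : Bool) (x : Vec Bool (suc n)) →
  run (fromFront i) (v ∷ removeAt x i) ≡ x [ i ]≔ v
run-fromFront zero    v (u ∷ x) = refl
run-fromFront {suc n} (suc i) v (u ∷ x@(_ ∷ _))
  rewrite run-lift (fromFront i) u (v ∷ removeAt x i) | run-fromFront i v x = refl

run-relocate : ∀ {n} (i j : Fin (suc n)) (x : Vec Bool (suc n)) →
  run (relocate i j) (removeAt x i) ≡ removeAt (x [ i ]≔ lookup x j) j
run-relocate zero zero (v ∷ x) = refl
run-relocate {suc n} zero    (suc j) (v ∷ x@(_ ∷ _)) = run-toFront j x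
run-relocate {suc n} (suc i) zero    (v ∷ x@(_ ∷ _)) = run-fromFront i v x
run-relocate {suc n} (suc i) (suc j) (v ∷ x@(_ ∷ _))
  rewrite run-lift (relocate i j) v (removeAt x i) | removeAt-suc v (x [ i ]≔ lookup x j) j
  = cong (v ∷_) (run-relocate i j x)

size-toFront : ∀ {n} (i : Fin (suc n)) → size (toFront i) ≡ 0
size-toFront zero            = refl
size-toFront {suc n} (suc i) = begin
  size (lift (toFront i) ++ swap₀₁ ∷ [])  ≡⟨ size-++ (lift (toFront i)) (swap₀₁ ∷ []) ⟩
  size (lift (toFront i)) + 0             ≡⟨ +-identityʳ _ ⟩
  size (lift (toFront i))                 ≡⟨ size-lift (toFront i) ⟩
  size (toFront i)                        ≡⟨ size-toFront i ⟩
  0                                       ∎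
  where open ≡-Reasoning

size-fromFront : ∀ {n} (i : Fin (suc n)) → size (fromFront i) ≡ 0
size-fromFront zero            = refl
size-fromFront {suc n} (suc i) = trans (size-lift (fromFront i)) (size-fromFront i)

size-relocate : ∀ {n} (i j : Fin (suc n)) → size (relocate i j) ≡ 0
size-relocate zero zero                = refl
size-relocate {suc n} zero    (suc j)  = size-toFront j
size-relocate {suc n} (suc i) zero     = size-fromFront i
size-relocate {suc n} (suc i) (suc j)  = trans (size-lift (relocate i j)) (size-relocate i j)

-- Pruning a channel along the path of a 1

follow : ∀ {n} → Op n → Fin n → Fin n
follow (cmp i j _) c with c ≟ i
... | yes _ = j
... | no  _ = c
follow (exch i j) c = transpose i j c

touches : ∀ {n} → Op n → Fin n → ℕ
touches (cmp i j _) c with c ≟ i | c ≟ j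
... | yes _ | _     = 1
... | no _  | yes _ = 1
... | no _  | no _  = 0
touches (exch _ _) _ = 0

pruneOp : ∀ {n} → Op (suc n) → Fin (suc n) → Network n
pruneOp (cmp i j i≢j) c with c ≟ i | c ≟ j
... | yes _   | _       = relocate i j
... | no _    | yes _   = []
... | no c≢i  | no c≢j  = cmp (punchOut c≢i) (punchOut c≢j) (i≢j ∘ punchOut-injective c≢i c≢j) ∷ []
pruneOp (exch i j) c with c ≟ i | c ≟ j
... | yes _   | _       = relocate i j
... | no _    | yes _   = relocate j i
... | no c≢i  | no c≢j  = exch (punchOut c≢i) (punchOut c≢j) ∷ []

size-pruneOp : ∀ {n} (o : Op (suc n)) (c : Fin (suc n)) → size (pruneOp o c) + touches o c ≡ size (o ∷ [])
size-pruneOp (cmp i j _) c with c ≟ i | c ≟ j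
... | yes _ | _     = cong (_+ 1) (size-relocate i j)
... | no _  | yes _ = refl
... | no _  | no _  = refl
size-pruneOp (exch i j) c with c ≟ i | c ≟ j
... | yes _ | _     = trans (+-identityʳ _) (size-relocate i j)
... | no _  | yes _ = trans (+-identityʳ _) (size-relocate j i)
... | no _  | no _  = refl

lookup-follow : ∀ {n} (o : Op n) (c : Fin n) (x : Vec Bool n) → lookup x c ≡ true →
  lookup (applyOp o x) (follow o c) ≡ true
lookup-follow (cmp i j _) c x xc with c ≟ i
... | yes refl rewrite lookup-[]≔ (x [ c ]≔ (lookup x c ∧ lookup x j)) j (lookup x c ∨ lookup x j) | xc = refl
... | no c≢i with c ≟ j
...   | yes refl rewrite lookup-[]≔ (x [ i ]≔ (lookup x i ∧ lookup x c)) c (lookup x i ∨ lookup x c) | xc = ∨-zeroʳ _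
...   | no c≢j rewrite lookup-[]≔-≢ (x [ i ]≔ (lookup x i ∧ lookup x j)) (lookup x i ∨ lookup x j) c≢j
                     | lookup-[]≔-≢ x (lookup x i ∧ lookup x j) c≢i = xc
lookup-follow (exch i j) c x xc with c ≟ i
... | yes refl rewrite lookup-[]≔ (x [ c ]≔ lookup x j) j (lookup x c) = xc
... | no c≢i with c ≟ j
...   | yes refl rewrite lookup-[]≔-≢ (x [ i ]≔ lookup x c) (lookup x i) (c≢i ∘ sym) | lookup-[]≔ x i (lookup x c) = xc
...   | no c≢j rewrite lookup-[]≔-≢ (x [ i ]≔ lookup x j) (lookup x i) c≢j | lookup-[]≔-≢ x (lookup x j) c≢i = xc

run-pruneOp : ∀ {n} (o : Op (suc n)) (c : Fin (suc n)) (x : Vec Bool (suc n)) → lookup x c ≡ true →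
  run (pruneOp o c) (removeAt x c) ≡ removeAt (applyOp o x) (follow o c)
run-pruneOp (cmp i j _) c x xc with c ≟ i | c ≟ j
... | yes refl | _ rewrite xc | removeAt-[]≔ (x [ c ]≔ lookup x j) j true = run-relocate c j x
... | no _ | yes refl rewrite xc | ∧-identityʳ (lookup x i) | []≔-lookup x i
                            | removeAt-[]≔ x c (lookup x i ∨ true) = refl
... | no c≢i | no c≢j
  rewrite removeAt-punchOut x c≢i | removeAt-punchOut x c≢j
        | removeAt-[]≔-punchOut (x [ i ]≔ (lookup x i ∧ lookup x j)) c≢j (lookup x i ∨ lookup x j)
        | removeAt-[]≔-punchOut x c≢i (lookup x i ∧ lookup x j) = refl
run-pruneOp (exch i j) c x xc with c ≟ i
... | yes refl rewrite removeAt-[]≔ (x [ c ]≔ lookup x j) j (lookup x c) = run-relocate c j x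
... | no c≢i with c ≟ j
...   | yes refl
  rewrite []≔-commutes {x = lookup x c} {y = lookup x i} x i c (c≢i ∘ sym)
        | removeAt-[]≔ (x [ c ]≔ lookup x i) i (lookup x c) = run-relocate c i x
...   | no c≢j
  rewrite removeAt-punchOut x c≢i | removeAt-punchOut x c≢j
        | removeAt-[]≔-punchOut (x [ i ]≔ lookup x j) c≢j (lookup x i)
        | removeAt-[]≔-punchOut x c≢i (lookup x j) = refl

target : ∀ {n} → Network n → Fin n → Fin n
target []      c = c
target (o ∷ C) c = target C (follow o c)

hits : ∀ {n} → Network n → Fin n → ℕ
hits []      c = 0
hits (o ∷ C) c = touches o c + hits C (follow o c)

prune : ∀ {n} → Network (suc n) → Fin (suc n) → Network n
prune []      c = []
prune (o ∷ C) c = pruneOp o c ++ prune C (follow o c)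

lookup-target : ∀ {n} (C : Network n) (c : Fin n) (x : Vec Bool n) → lookup x c ≡ true →
  lookup (run C x) (target C c) ≡ true
lookup-target []      c x xc = xc
lookup-target (o ∷ C) c x xc = lookup-target C (follow o c) (applyOp o x) (lookup-follow o c x xc)

run-prune : ∀ {n} (C : Network (suc n)) (c : Fin (suc n)) (x : Vec Bool (suc n)) → lookup x c ≡ true →
  run (prune C c) (removeAt x c) ≡ removeAt (run C x) (target C c)
run-prune []      c x xc = refl
run-prune (o ∷ C) c x xc = begin
  run (pruneOp o c ++ prune C (follow o c)) (removeAt x c)   ≡⟨ run-++ (pruneOp o c) _ (removeAt x c) ⟩
  run (prune C (follow o c)) (run (pruneOp o c) (removeAt x c))
    ≡⟨ cong (run (prune C (follow o c))) (run-pruneOp o c x xc) ⟩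
  run (prune C (follow o c)) (removeAt (applyOp o x) (follow o c))
    ≡⟨ run-prune C (follow o c) (applyOp o x) (lookup-follow o c x xc) ⟩
  removeAt (run C (applyOp o x)) (target C (follow o c))     ∎
  where open ≡-Reasoning

size-∷ : ∀ {n} (o : Op n) (C : Network n) → size (o ∷ C) ≡ size (o ∷ []) + size C
size-∷ (cmp _ _ _) C = refl
size-∷ (exch _ _)  C = refl

size-prune : ∀ {n} (C : Network (suc n)) (c : Fin (suc n)) → size (prune C c) + hits C c ≡ size C
size-prune []      c = refl
size-prune (o ∷ C) c = begin
  size (pruneOp o c ++ prune C c′) + (touches o c + hits C c′)
    ≡⟨ cong (_+ (touches o c + hits C c′)) (size-++ (pruneOp o c) (prune C c′)) ⟩
  (size (pruneOp o c) + size (prune C c′)) + (touches o c + hits C c′)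
    ≡⟨ +-interchange (size (pruneOp o c)) (size (prune C c′)) (touches o c) (hits C c′) ⟩
  (size (pruneOp o c) + touches o c) + (size (prune C c′) + hits C c′)
    ≡⟨ cong₂ _+_ (size-pruneOp o c) (size-prune C c′) ⟩
  size (o ∷ []) + size C
    ≡⟨ sym (size-∷ o C) ⟩
  size (o ∷ C)                                                    ∎
  where
  open ≡-Reasoning
  c′ = follow o c

-- Kraft's inequality for the paths

Token : ℕ → Set
Token n = Fin n × ℕ

mass : ∀ {n} → List (Token n) → Fin n → ℕ
mass []            z = 0
mass ((c , w) ∷ t) z with c ≟ z
... | yes _ = w + mass t z
... | no  _ = mass t z

total : ∀ {n} → List (Token n) → ℕ
total t = sum (map proj₂ t)

move : ∀ {n} → (Fin n → Fin n) → List (Token n) → List (Token n)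
move f = map (map₁ f)

mass-here : ∀ {n} (c : Fin n) (w : ℕ) (t : List (Token n)) → mass ((c , w) ∷ t) c ≡ w + mass t c
mass-here c w t with c ≟ c
... | yes _   = refl
... | no c≢c  = ⊥-elim (c≢c refl)

mass-elsewhere : ∀ {n} {c z : Fin n} (w : ℕ) (t : List (Token n)) → c ≢ z → mass ((c , w) ∷ t) z ≡ mass t z
mass-elsewhere {c = c} {z} w t c≢z with c ≟ z
... | yes c≡z = ⊥-elim (c≢z c≡z)
... | no  _   = refl

mass-∷-≥ : ∀ {n} (tok : Token n) (t : List (Token n)) (z : Fin n) → mass t z ≤ mass (tok ∷ t) z
mass-∷-≥ (c , w) t z with c ≟ z
... | yes _ = m≤n+m (mass t z) w
... | no  _ = ≤-refl

sum-map-mono : ∀ {A : Set} {f g : A → ℕ} → (∀ a → f a ≤ g a) → (xs : List A) → sum (map f xs) ≤ sum (map g xs)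
sum-map-mono f≤g []       = z≤n
sum-map-mono f≤g (a ∷ xs) = +-mono-≤ (f≤g a) (sum-map-mono f≤g xs)

mass-∷-∈ : ∀ {n} (c : Fin n) (w : ℕ) (t : List (Token n)) {ps : List (Fin n)} → c ∈ ps →
  w + sum (map (mass t) ps) ≤ sum (map (mass ((c , w) ∷ t)) ps)
mass-∷-∈ c w t {c ∷ ps} (here refl) rewrite mass-here c w t = begin
  w + (mass t c + sum (map (mass t) ps))   ≡⟨ sym (+-assoc w _ _) ⟩
  w + mass t c + sum (map (mass t) ps)     ≤⟨ +-monoʳ-≤ (w + mass t c) (sum-map-mono (mass-∷-≥ (c , w) t) ps) ⟩
  w + mass t c + sum (map (mass ((c , w) ∷ t)) ps) ∎
  where open ≤-Reasoning
mass-∷-∈ c w t {p ∷ ps} (there c∈ps) = begin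
  w + (mass t p + sum (map (mass t) ps))   ≡⟨ x+[y+z]≡y+[x+z] w (mass t p) _ ⟩
  mass t p + (w + sum (map (mass t) ps))   ≤⟨ +-mono-≤ (mass-∷-≥ (c , w) t p) (mass-∷-∈ c w t c∈ps) ⟩
  mass ((c , w) ∷ t) p + sum (map (mass ((c , w) ∷ t)) ps) ∎
  where open ≤-Reasoning

mass-move : ∀ {n} (f : Fin n → Fin n) (z : Fin n) (ps : List (Fin n)) → (∀ c → f c ≡ z → c ∈ ps) →
  (t : List (Token n)) → mass (move f t) z ≤ sum (map (mass t) ps)
mass-move f z ps pre []            = z≤n
mass-move f z ps pre ((c , w) ∷ t) with f c ≟ z
... | yes fc≡z = ≤-trans (+-monoʳ-≤ w (mass-move f z ps pre t)) (mass-∷-∈ c w t (pre c fc≡z))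
... | no  _    = ≤-trans (mass-move f z ps pre t) (sum-map-mono (mass-∷-≥ (c , w) t) ps)

total-move : ∀ {n} (f : Fin n → Fin n) (t : List (Token n)) → total (move f t) ≡ total t
total-move f t = cong sum (sym (map-∘ t))

total-≤-mass : ∀ {n} (z : Fin n) (t : List (Token n)) → All (λ tok → proj₁ tok ≡ z) t → total t ≤ mass t z
total-≤-mass z []            []          = z≤n
total-≤-mass z ((c , w) ∷ t) (refl ∷ at) rewrite mass-here c w t = +-monoʳ-≤ w (total-≤-mass c t at)

follow-cmp-preimage : ∀ {n} (i j : Fin n) (i≢j : i ≢ j) {c z : Fin n} → follow (cmp i j i≢j) c ≡ z →
  (c ≡ i × z ≡ j) ⊎ (c ≢ i × c ≡ z)
follow-cmp-preimage i j _ {c} e with c ≟ i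
... | yes c≡i = inj₁ (c≡i , sym e)
... | no  c≢i = inj₂ (c≢i , e)

hits-cmp-min : ∀ {n} (i j : Fin n) (i≢j : i ≢ j) (C : Network n) → hits (cmp i j i≢j ∷ C) i ≡ suc (hits C j)
hits-cmp-min i j _ C with i ≟ i
... | yes _   = refl
... | no i≢i  = ⊥-elim (i≢i refl)

hits-cmp-max : ∀ {n} (i j : Fin n) (i≢j : i ≢ j) (C : Network n) → hits (cmp i j i≢j ∷ C) j ≡ suc (hits C j)
hits-cmp-max i j _ C with j ≟ i | j ≟ j
... | yes _ | _      = refl
... | no _  | yes _  = refl
... | no _  | no j≢j = ⊥-elim (j≢j refl)

hits-cmp-other : ∀ {n} (i j : Fin n) (i≢j : i ≢ j) (C : Network n) {z : Fin n} → z ≢ i → z ≢ j →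
  hits (cmp i j i≢j ∷ C) z ≡ hits C z
hits-cmp-other i j _ C {z} z≢i z≢j with z ≟ i | z ≟ j
... | yes z≡i | _       = ⊥-elim (z≢i z≡i)
... | no _    | yes z≡j = ⊥-elim (z≢j z≡j)
... | no _    | no _    = refl

-- The invariant behind Kraft's inequality, scaled by 2 ^ T: the weight at z still
-- fits into 2 ^ T after doubling it at each of the hits C z comparators ahead.
Bounded : ∀ {n} → Network n → ℕ → List (Token n) → Set
Bounded C T t = ∀ z → mass t z * 2 ^ hits C z ≤ 2 ^ T

halves-≤ : ∀ a b k P → a * (2 * k) ≤ P → b * (2 * k) ≤ P → (a + b) * k ≤ P
halves-≤ a b k P a≤ b≤ = *-cancelˡ-≤ 2 (begin
  2 * ((a + b) * k)          ≡⟨ distrib a b k ⟩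
  a * (2 * k) + b * (2 * k)  ≤⟨ +-mono-≤ a≤ b≤ ⟩
  P + P                      ≡⟨ cong (P +_) (sym (+-identityʳ P)) ⟩
  2 * P                      ∎)
  where
  open ≤-Reasoning
  distrib : ∀ a b k → 2 * ((a + b) * k) ≡ a * (2 * k) + b * (2 * k)
  distrib = solve-∀

Bounded-follow-cmp : ∀ {n} (i j : Fin n) (i≢j : i ≢ j) (C : Network n) (T : ℕ) (t : List (Token n)) →
  Bounded (cmp i j i≢j ∷ C) T t → Bounded C T (move (follow (cmp i j i≢j)) t)
Bounded-follow-cmp i j i≢j C T t bounded z with z ≟ j | z ≟ i
... | yes refl | _ = begin
  mass (move (follow o) t) j * 2 ^ hits C j   ≤⟨ *-monoˡ-≤ _ (mass-move (follow o) j (i ∷ j ∷ []) from-i-or-j t) ⟩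
  (mass t i + (mass t j + 0)) * 2 ^ hits C j  ≡⟨ cong (λ m → (mass t i + m) * 2 ^ hits C j) (+-identityʳ (mass t j)) ⟩
  (mass t i + mass t j) * 2 ^ hits C j        ≤⟨ halves-≤ (mass t i) (mass t j) _ _ (halved (hits-cmp-min i j i≢j C))
                                                                                     (halved (hits-cmp-max i j i≢j C)) ⟩
  2 ^ T                                       ∎
  where
  open ≤-Reasoning
  o = cmp i j i≢j
  from-i-or-j : ∀ c → follow o c ≡ j → c ∈ i ∷ j ∷ []
  from-i-or-j c e = [ here ∘ proj₁ , there ∘ here ∘ proj₂ ]′ (follow-cmp-preimage i j i≢j {c} e)
  halved : ∀ {c} → hits (o ∷ C) c ≡ suc (hits C j) → mass t c * (2 * 2 ^ hits C j) ≤ 2 ^ T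
  halved {c} e = subst (λ k → mass t c * 2 ^ k ≤ 2 ^ T) e (bounded c)
... | no z≢j | yes refl = ≤-trans (*-monoˡ-≤ _ (mass-move (follow o) i [] from-nowhere t)) z≤n
  where
  o = cmp i j i≢j
  from-nowhere : ∀ c → follow o c ≡ i → c ∈ []
  from-nowhere c e = [ ⊥-elim ∘ z≢j ∘ proj₂ , (λ (c≢i , c≡i) → ⊥-elim (c≢i c≡i)) ]′ (follow-cmp-preimage i j i≢j {c} e)
... | no z≢j | no z≢i = begin
  mass (move (follow o) t) z * 2 ^ hits C z   ≤⟨ *-monoˡ-≤ _ (mass-move (follow o) z (z ∷ []) from-z t) ⟩
  (mass t z + 0) * 2 ^ hits C z               ≡⟨ cong (_* 2 ^ hits C z) (+-identityʳ (mass t z)) ⟩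
  mass t z * 2 ^ hits C z                     ≡⟨ cong (λ k → mass t z * 2 ^ k) (sym (hits-cmp-other i j i≢j C z≢i z≢j)) ⟩
  mass t z * 2 ^ hits (o ∷ C) z               ≤⟨ bounded z ⟩
  2 ^ T                                       ∎
  where
  open ≤-Reasoning
  o = cmp i j i≢j
  from-z : ∀ c → follow o c ≡ z → c ∈ z ∷ []
  from-z c e = [ ⊥-elim ∘ z≢j ∘ proj₂ , here ∘ proj₂ ]′ (follow-cmp-preimage i j i≢j {c} e)

Bounded-follow-exch : ∀ {n} (i j : Fin n) (C : Network n) (T : ℕ) (t : List (Token n)) →
  Bounded (exch i j ∷ C) T t → Bounded C T (move (transpose i j) t)
Bounded-follow-exch i j C T t bounded z = begin
  mass (move (transpose i j) t) z * 2 ^ hits C z  ≤⟨ *-monoˡ-≤ _ (mass-move (transpose i j) z (z′ ∷ []) from-z′ t) ⟩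
  (mass t z′ + 0) * 2 ^ hits C z                  ≡⟨ cong (_* 2 ^ hits C z) (+-identityʳ (mass t z′)) ⟩
  mass t z′ * 2 ^ hits C z                        ≡⟨ cong (λ c → mass t z′ * 2 ^ hits C c) (sym (transpose-inverse i j)) ⟩
  mass t z′ * 2 ^ hits C (transpose i j z′)       ≤⟨ bounded z′ ⟩
  2 ^ T                                           ∎
  where
  open ≤-Reasoning
  z′ = transpose j i z
  from-z′ : ∀ c → transpose i j c ≡ z → c ∈ z′ ∷ []
  from-z′ c e = here (trans (sym (transpose-inverse j i)) (cong (transpose j i) e))

Bounded-follow : ∀ {n} (o : Op n) (C : Network n) (T : ℕ) (t : List (Token n)) →
  Bounded (o ∷ C) T t → Bounded C T (move (follow o) t)
Bounded-follow (cmp i j i≢j) = Bounded-follow-cmp i j i≢j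
Bounded-follow (exch i j)    = Bounded-follow-exch i j

kraft-tokens : ∀ {n} (C : Network n) (T : ℕ) (z : Fin n) (t : List (Token n)) →
  Bounded C T t → All (λ tok → target C (proj₁ tok) ≡ z) t → total t ≤ 2 ^ T
kraft-tokens []      T z t bounded at = begin
  total t             ≤⟨ total-≤-mass z t at ⟩
  mass t z            ≡⟨ sym (*-identityʳ (mass t z)) ⟩
  mass t z * 1        ≤⟨ bounded z ⟩
  2 ^ T               ∎
  where open ≤-Reasoning
kraft-tokens (o ∷ C) T z t bounded at = begin
  total t                     ≡⟨ sym (total-move (follow o) t) ⟩
  total (move (follow o) t)   ≤⟨ kraft-tokens C T z (move (follow o) t) (Bounded-follow o C T t bounded) (All-map⁺ at) ⟩
  2 ^ T                       ∎
  where open ≤-Reasoning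

tokens : ∀ {n} → (Fin n → ℕ) → List (Fin n) → List (Token n)
tokens w = map (λ c → c , w c)

mass-tokens-absent : ∀ {n} (w : Fin n → ℕ) {z : Fin n} (cs : List (Fin n)) → All (z ≢_) cs → mass (tokens w cs) z ≡ 0
mass-tokens-absent w []       []           = refl
mass-tokens-absent w (c ∷ cs) (z≢c ∷ z∉cs) =
  trans (mass-elsewhere (w c) (tokens w cs) (z≢c ∘ sym)) (mass-tokens-absent w cs z∉cs)

Bounded-tokens : ∀ {n} (C : Network n) (T : ℕ) (w : Fin n → ℕ) (cs : List (Fin n)) → Unique cs →
  All (λ c → w c * 2 ^ hits C c ≤ 2 ^ T) cs → Bounded C T (tokens w cs)
Bounded-tokens C T w []       []                 []            z = z≤n
Bounded-tokens C T w (c ∷ cs) (c∉cs ∷ unique-cs) (wc≤ ∷ ws≤)  z with c ≟ z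
... | yes refl rewrite mass-tokens-absent w cs c∉cs | +-identityʳ (w c) = wc≤
... | no  _    = Bounded-tokens C T w cs unique-cs ws≤ z

-- For T = 0 and w ≡ 1 this reads ∑ 2 ^ (- hits C c) ≤ 1 over the paths ending at z.
kraft : ∀ {n} (C : Network n) (T : ℕ) (z : Fin n) (w : Fin n → ℕ) (cs : List (Fin n)) → Unique cs →
  All (λ c → target C c ≡ z) cs → All (λ c → w c * 2 ^ hits C c ≤ 2 ^ T) cs → sum (map w cs) ≤ 2 ^ T
kraft C T z w cs unique-cs ends-at-z bounded =
  subst (_≤ 2 ^ T) (cong sum (sym (map-∘ cs)))
    (kraft-tokens C T z (tokens w cs) (Bounded-tokens C T w cs unique-cs bounded) (All-map⁺ ends-at-z))

-- The greedy 1 + max merging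

sumPow2 : List ℕ → ℕ
sumPow2 l = sum (map (2 ^_) l)

insertSorted-↭ : ∀ a l → insertSorted a l ↭ a ∷ l
insertSorted-↭ a []      = ↭.refl
insertSorted-↭ a (b ∷ l) with a ≤ᵇ b
... | true  = ↭.refl
... | false = ↭.trans (↭.prep b (insertSorted-↭ a l)) (↭.swap b a ↭.refl)

sortℕ-↭ : ∀ l → sortℕ l ↭ l
sortℕ-↭ []      = ↭.refl
sortℕ-↭ (a ∷ l) = ↭.trans (insertSorted-↭ a (sortℕ l)) (↭.prep a (sortℕ-↭ l))

insertSorted-sorted : ∀ a l → AllPairs _≤_ l → AllPairs _≤_ (insertSorted a l)
insertSorted-sorted a []      []               = [] ∷ []
insertSorted-sorted a (b ∷ l) (b≤l ∷ l-sorted) with a ≤ᵇ b in a≤ᵇb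
... | true  = (a≤b ∷ All.map (≤-trans a≤b) b≤l) ∷ b≤l ∷ l-sorted
  where a≤b = ≤ᵇ⇒≤ a b (subst T (sym a≤ᵇb) _)
... | false = All-resp-↭ (↭-sym (insertSorted-↭ a l)) (b≤a ∷ b≤l) ∷ insertSorted-sorted a l l-sorted
  where b≤a = ≰⇒≥ (λ a≤b → subst T a≤ᵇb (≤⇒≤ᵇ a≤b))

sortℕ-sorted : ∀ l → AllPairs _≤_ (sortℕ l)
sortℕ-sorted []      = []
sortℕ-sorted (a ∷ l) = insertSorted-sorted a (sortℕ l) (sortℕ-sorted l)

sumPow2-↭ : ∀ {l l′} → l ↭ l′ → sumPow2 l ≡ sumPow2 l′
sumPow2-↭ l↭l′ = sum-↭ (↭-map⁺ (2 ^_) l↭l′)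

2^-cancel-≤ : ∀ {m n} → 2 ^ m ≤ 2 ^ n → m ≤ n
2^-cancel-≤ 2^m≤2^n = ≮⇒≥ (λ n<m → <⇒≱ (^-monoʳ-< 2 (s≤s (s≤s z≤n)) n<m) 2^m≤2^n)

2^-∣ : ∀ {m n} → m ≤ n → 2 ^ m ∣ 2 ^ n
2^-∣ {m} {n} m≤n = divides (2 ^ (n ∸ m)) (begin
  2 ^ n               ≡⟨ cong (2 ^_) (sym (m+[n∸m]≡n m≤n)) ⟩
  2 ^ (m + (n ∸ m))   ≡⟨ ^-distribˡ-+-* 2 m (n ∸ m) ⟩
  2 ^ m * 2 ^ (n ∸ m) ≡⟨ *-comm (2 ^ m) _ ⟩
  2 ^ (n ∸ m) * 2 ^ m ∎)
  where open ≡-Reasoning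

2^-∣-sumPow2 : ∀ {b} l → All (b ≤_) l → 2 ^ b ∣ sumPow2 l
2^-∣-sumPow2 {b} []      []          = (2 ^ b) ∣0
2^-∣-sumPow2     (a ∷ l) (b≤a ∷ b≤l) = ∣m∣n⇒∣m+n (2^-∣ b≤a) (2^-∣-sumPow2 l b≤l)

next-multiple : ∀ {d x y} → d ∣ x → d ∣ y → x < y → d + x ≤ y
next-multiple {d} (divides q refl) (divides r refl) x<y = *-monoˡ-≤ d (*-cancelʳ-< d q r x<y)

-- All of 2 ^ b + S and 2 ^ T are multiples of 2 ^ b, so the positive slack
-- 2 ^ a forces a slack of a whole 2 ^ b.
merge-≤ : ∀ a b {S T} → 2 ^ b ∣ S → 2 ^ a + (2 ^ b + S) ≤ 2 ^ T → 2 ^ suc b + S ≤ 2 ^ T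
merge-≤ a b {S} {T} 2^b∣S le = begin
  2 ^ suc b + S          ≡⟨ cong (_+ S) (cong (2 ^ b +_) (+-identityʳ (2 ^ b))) ⟩
  2 ^ b + 2 ^ b + S      ≡⟨ +-assoc (2 ^ b) (2 ^ b) S ⟩
  2 ^ b + (2 ^ b + S)    ≤⟨ next-multiple (∣m∣n⇒∣m+n ∣-refl 2^b∣S) (2^-∣ {b} {T} b≤T) (≤-trans (+-monoˡ-≤ _ (m^n>0 2 a)) le) ⟩
  2 ^ T                  ∎
  where
  open ≤-Reasoning
  b≤T : b ≤ T
  b≤T = 2^-cancel-≤ (≤-trans (m≤m+n (2 ^ b) S) (≤-trans (m≤n+m _ (2 ^ a)) le))

Hgo-≤ : ∀ fuel l T → AllPairs _≤_ l → sumPow2 l ≤ 2 ^ T → Hgo fuel l ≤ T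
Hgo-≤ fuel       []          T _ _ = z≤n
Hgo-≤ fuel       (a ∷ [])    T _ le = 2^-cancel-≤ (subst (_≤ 2 ^ T) (+-identityʳ (2 ^ a)) le)
Hgo-≤ zero       (a ∷ b ∷ l) T _ _ = z≤n
Hgo-≤ (suc fuel) (a ∷ b ∷ l) T ((a≤b ∷ _) ∷ b≤l ∷ l-sorted) le rewrite m≤n⇒m⊔n≡n a≤b =
  Hgo-≤ fuel (insertSorted (suc b) l) T (insertSorted-sorted (suc b) l l-sorted)
    (subst (_≤ 2 ^ T) (sym (sumPow2-↭ (insertSorted-↭ (suc b) l))) (merge-≤ a b {T = T} (2^-∣-sumPow2 l b≤l) le))

H1max-≤ : ∀ l T → sumPow2 l ≤ 2 ^ T → H1max l ≤ T
H1max-≤ l T le = Hgo-≤ (length l) (sortℕ l) T (sortℕ-sorted l) (subst (_≤ 2 ^ T) (sym (sumPow2-↭ (sortℕ-↭ l))) le)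

prunable-unique : ∀ {n} (X : SeqSet n) → Unique (prunable X)
prunable-unique {n} X = Unique.filter⁺ (T? ∘ X ∘ oneHot) (Unique.allFin⁺ n)

prunable-oneHot : ∀ {n} (X : SeqSet n) → All (λ i → X (oneHot i) ≡ true) (prunable X)
prunable-oneHot {n} X = All.map (Equivalence.to T-≡) (all-filter (T? ∘ X ∘ oneHot) (allFin n))

prune-sorts : ∀ {m} (X : SeqSet (suc m)) (C : Network (suc m)) → SortsOn X C →
  (i : Fin (suc m)) → SortsOn (X / i) (prune C i)
prune-sorts X C sorts i y y∈X/i = subst Sorted pruned (Sorted-removeAt (run C x) (target C i) (sorts x y∈X/i))
  where
  x = insertAt y i true
  pruned : removeAt (run C x) (target C i) ≡ run (prune C i) y
  pruned = trans (sym (run-prune C i x (insertAt-lookup y i true))) (cong (run (prune C i)) (removeAt-insertAt y i true))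

minSize-/-+-hits-≤ : ∀ {m} (X : SeqSet (suc m)) (C : Network (suc m)) → SortsOn X C →
  (i : Fin (suc m)) {s : ℕ} → IsMinSize (X / i) s → s + hits C i ≤ size C
minSize-/-+-hits-≤ X C sorts i (_ , minimal) = begin
  _ + hits C i                    ≤⟨ +-monoˡ-≤ (hits C i) (minimal (prune C i) (prune-sorts X C sorts i)) ⟩
  size (prune C i) + hits C i     ≡⟨ size-prune C i ⟩
  size C                          ∎
  where open ≤-Reasoning

-- The tracked 1 of the one-hot input is the only 1 of the sorted output.
target-oneHot : ∀ {m} (X : SeqSet (suc m)) (C : Network (suc m)) → SortsOn X C →
  (i : Fin (suc m)) → X (oneHot i) ≡ true → target C i ≡ fromℕ m
target-oneHot X C sorts i e-i∈X = lone-true-at-last (run C (oneHot i)) (target C i) (sorts (oneHot i) e-i∈X)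
  (lookup-target C i (oneHot i) (lookup-oneHot i))
  (begin
    removeAt (run C (oneHot i)) (target C i)   ≡⟨ sym (run-prune C i (oneHot i) (lookup-oneHot i)) ⟩
    run (prune C i) (removeAt (oneHot i) i)    ≡⟨ cong (run (prune C i)) (removeAt-oneHot i) ⟩
    run (prune C i) (replicate _ false)        ≡⟨ run-replicate-false (prune C i) ⟩
    replicate _ false                          ∎)
  where open ≡-Reasoning

mainTheorem3 : (m : ℕ) (X : SeqSet (suc m)) →
    (∃ λ (i : Fin (suc m)) → X (oneHot i) ≡ true) →
    (sX : ℕ) → IsMinSize X sX →
    (s/ : Fin (suc m) → ℕ) →
    ((i : Fin (suc m)) → X (oneHot i) ≡ true → IsMinSize (X / i) (s/ i)) →
    H1max (map s/ (prunable X)) ≤ sX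
mainTheorem3 m X _ sX ((C , sorts , refl) , _) s/ minSize-/ =
  H1max-≤ (map s/ (prunable X)) (size C) (subst (_≤ 2 ^ size C) (cong sum (map-∘ (prunable X)))
    (kraft C (size C) (fromℕ m) (λ i → 2 ^ s/ i) (prunable X) (prunable-unique X)
      (All.map (target-oneHot X C sorts _) (prunable-oneHot X))
      (All.map (weight-bound _) (prunable-oneHot X))))
  where
  weight-bound : ∀ i → X (oneHot i) ≡ true → 2 ^ s/ i * 2 ^ hits C i ≤ 2 ^ size C
  weight-bound i e-i∈X = begin
    2 ^ s/ i * 2 ^ hits C i  ≡⟨ sym (^-distribˡ-+-* 2 (s/ i) (hits C i)) ⟩
    2 ^ (s/ i + hits C i)    ≤⟨ ^-monoʳ-≤ 2 (minSize-/-+-hits-≤ X C sorts i (minSize-/ i e-i∈X)) ⟩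
    2 ^ size C               ∎
    where open ≤-Reasoning
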